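{- Let $n \ge 0$ be an integer. If $\lambda=(p_1,\dots,p_r)$ and $\mu=(q_1,\dots,q_s)$ are two distinct partitions of $n$ all of whose parts are prime numbers, then $\frac{n!}{p_1!\cdots p_r!} \neq \frac{n!}{q_1!\cdots q_s!}$; that is, distinct partitions of $n$ into primes yield different multinomial coefficients.
   Context: Two partitions are distinct if their multisets of parts differ. -}

module Defs where

open import Data.Nat using (ℕ; _*_; _/_; NonZero; _!)
open import Data.Nat.Properties using (m*n≢0; _!≢0)
open import Data.Nat.Primality using (Prime)
open import Data.List using (List; []; _∷_)
open import Data.Nat.ListAction using (sum)
open import Data.List.Relation.Unary.All using (All)
open import Relation.Binary.PropositionalEquality using (_≡_)
open import Data.Product using (_×_)

prodFact : List ℕ → ℕ
prodFact []       = 1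
prodFact (p ∷ ps) = p ! * prodFact ps

prodFact≢0 : ∀ ps → NonZero (prodFact ps)
prodFact≢0 []       = _
prodFact≢0 (p ∷ ps) = m*n≢0 (p !) (prodFact ps) {{p !≢0}} {{prodFact≢0 ps}}

multinomial : ℕ → List ℕ → ℕ
multinomial n ps = (n ! / prodFact ps) {{prodFact≢0 ps}}

-- λ is a partition of n all of whose parts are prime
-- (a partition is represented as a list of parts; order is irrelevant,
--  multisets are compared via permutation _↭_)
PrimePartition : ℕ → List ℕ → Set
PrimePartition n ps = All Prime ps × sum ps ≡ n

-- Since p₁! ⋯ pᵣ! divides n !, the multinomial coefficient determines p₁! ⋯ pᵣ!.
-- A prime divides m ! only if it is at most m, so when all parts are prime the largest
-- prime dividing p₁! ⋯ pᵣ! is the largest part. Cancelling its factorial and iterating,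
-- the product determines the whole multiset of parts.
module Submission where

open import Defs
open import Data.Nat using (ℕ)
open import Data.List using (List)
open import Data.List.Relation.Binary.Permutation.Propositional using (_↭_)
open import Relation.Nullary using (¬_)
open import Relation.Binary.PropositionalEquality using (_≢_)

open import Data.Nat using (suc; _+_; _*_; _≤_; _≥_; _!; NonZero; ≢-nonZero; ≢-nonZero⁻¹; nonTrivial⇒≢1)
open import Data.Nat.Properties using (≤-refl; ≤-trans; ≤-antisym; m≤m+n; m+n∸m≡n; m≤n⇒m≤1+n; *-cancelˡ-≡; _!≢0; ≤-decTotalOrder)
open import Data.Nat.Divisibility using (_∣_; ∣-refl; ∣-trans; ∣⇒≤; ∣1⇒≡1; m∣m*n; *-monoʳ-∣)
open import Data.Nat.DivMod using (m/n*n≡m)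
open import Data.Nat.Combinatorics using (k![n∸k]!∣n!)
open import Data.Nat.Primality using (Prime; euclidsLemma; prime⇒nonZero; prime⇒nonTrivial)
open import Data.Nat.ListAction using (sum; product)
open import Data.Nat.ListAction.Properties using (product-↭)
open import Data.List using ([]; _∷_; map)
open import Data.List.Relation.Unary.All using (All; []; _∷_; lookupWith)
open import Data.List.Relation.Unary.Any using (Any; here; there)
open import Data.List.Relation.Unary.Linked using (Linked; tail)
open import Data.List.Relation.Unary.Linked.Properties using (Linked⇒All)
open import Data.List.Relation.Binary.Permutation.Propositional using (↭-trans; ↭-sym)
open import Data.List.Relation.Binary.Permutation.Propositional.Properties using (map⁺; All-resp-↭)
open import Relation.Binary.Properties.DecTotalOrder ≤-decTotalOrder using (≥-decTotalOrder)
open import Data.List.Sort ≥-decTotalOrder using (sort; sort-↭; sort-↗)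
open import Data.Product using (_,_)
open import Data.Empty using (⊥-elim)
open import Data.Sum using (inj₁; inj₂)
open import Function using (flip)
open import Relation.Binary.PropositionalEquality using (_≡_; refl; sym; trans; cong; cong₂; subst; module ≡-Reasoning)

prime∤1 : ∀ {p} → Prime p → ¬ p ∣ 1
prime∤1 pp p∣1 = nonTrivial⇒≢1 {{prime⇒nonTrivial pp}} (∣1⇒≡1 p∣1)

n∣n! : ∀ n → .{{NonZero n}} → n ∣ n !
n∣n! (suc n) = m∣m*n (n !)

prime∣n!⇒≤ : ∀ {p} n → Prime p → p ∣ n ! → p ≤ n
prime∣n!⇒≤ 0       pp p∣1 = ⊥-elim (prime∤1 pp p∣1)
prime∣n!⇒≤ (suc n) pp p∣n! with euclidsLemma (suc n) (n !) pp p∣n!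
... | inj₁ p∣1+n = ∣⇒≤ p∣1+n
... | inj₂ p∣n!  = m≤n⇒m≤1+n (prime∣n!⇒≤ n pp p∣n!)

prodFact≡product∘map! : ∀ xs → prodFact xs ≡ product (map _! xs)
prodFact≡product∘map! []       = refl
prodFact≡product∘map! (x ∷ xs) = cong (x ! *_) (prodFact≡product∘map! xs)

prodFact-↭ : ∀ {xs ys} → xs ↭ ys → prodFact xs ≡ prodFact ys
prodFact-↭ {xs} {ys} xs↭ys = begin
  prodFact xs          ≡⟨ prodFact≡product∘map! xs ⟩
  product (map _! xs)  ≡⟨ product-↭ (map⁺ _! xs↭ys) ⟩
  product (map _! ys)  ≡⟨ prodFact≡product∘map! ys ⟨
  prodFact ys          ∎
  where open ≡-Reasoning

prodFact∣[sum]! : ∀ xs → prodFact xs ∣ sum xs !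
prodFact∣[sum]! []       = ∣-refl
prodFact∣[sum]! (x ∷ xs) = ∣-trans (*-monoʳ-∣ (x !) (prodFact∣[sum]! xs)) x![sum]!∣[x+sum]!
  where
  x![sum]!∣[x+sum]! : x ! * sum xs ! ∣ (x + sum xs) !
  x![sum]!∣[x+sum]! = subst (λ s → x ! * s ! ∣ (x + sum xs) !) (m+n∸m≡n x (sum xs))
                              (k![n∸k]!∣n! (m≤m+n x (sum xs)))

multinomial*prodFact≡n! : ∀ {n} xs → sum xs ≡ n → multinomial n xs * prodFact xs ≡ n !
multinomial*prodFact≡n! {n} xs refl = m/n*n≡m {{prodFact≢0 xs}} (prodFact∣[sum]! xs)

multinomial≡⇒prodFact≡ : ∀ {n} xs ys → sum xs ≡ n → sum ys ≡ n →
                         multinomial n xs ≡ multinomial n ys → prodFact xs ≡ prodFact ys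
multinomial≡⇒prodFact≡ {n} xs ys Σxs Σys eq =
  *-cancelˡ-≡ (prodFact xs) (prodFact ys) (multinomial n xs) {{≢-nonZero multinomial≢0}} (begin
    multinomial n xs * prodFact xs  ≡⟨ multinomial*prodFact≡n! xs Σxs ⟩
    n !                             ≡⟨ multinomial*prodFact≡n! ys Σys ⟨
    multinomial n ys * prodFact ys  ≡⟨ cong (_* prodFact ys) eq ⟨
    multinomial n xs * prodFact ys  ∎)
  where
  open ≡-Reasoning
  multinomial≢0 : multinomial n xs ≢ 0
  multinomial≢0 m≡0 = ≢-nonZero⁻¹ (n !) {{n !≢0}}
    (trans (sym (multinomial*prodFact≡n! xs Σxs)) (cong (_* prodFact xs) m≡0))

Descending : List ℕ → Set
Descending = Linked _≥_

prime∣prodFact⇒≤part : ∀ {p} xs → Prime p → p ∣ prodFact xs → Any (p ≤_) xs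
prime∣prodFact⇒≤part []       pp p∣1 = ⊥-elim (prime∤1 pp p∣1)
prime∣prodFact⇒≤part (x ∷ xs) pp p∣prod with euclidsLemma (x !) (prodFact xs) pp p∣prod
... | inj₁ p∣x! = here (prime∣n!⇒≤ x pp p∣x!)
... | inj₂ p∣xs = there (prime∣prodFact⇒≤part xs pp p∣xs)

prime∣prodFact⇒≤head : ∀ {p x xs} → Prime p → Descending (x ∷ xs) → p ∣ prodFact (x ∷ xs) → p ≤ x
prime∣prodFact⇒≤head {x = x} {xs} pp desc p∣prod =
  lookupWith (λ y≤x p≤y → ≤-trans p≤y y≤x)
             (Linked⇒All (flip ≤-trans) ≤-refl desc)
             (prime∣prodFact⇒≤part (x ∷ xs) pp p∣prod)

x∣prodFact[x∷xs] : ∀ x xs → .{{NonZero x}} → x ∣ prodFact (x ∷ xs)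
x∣prodFact[x∷xs] x xs = ∣-trans (n∣n! x) (m∣m*n (prodFact xs))

prodFact[p∷ps]≢1 : ∀ {p} ps → Prime p → prodFact (p ∷ ps) ≢ 1
prodFact[p∷ps]≢1 {p} ps pp prod≡1 =
  prime∤1 pp (subst (p ∣_) prod≡1 (x∣prodFact[x∷xs] p ps {{prime⇒nonZero pp}}))

prodFact-injective-descending : ∀ {xs ys} → Descending xs → Descending ys →
                                All Prime xs → All Prime ys → prodFact xs ≡ prodFact ys → xs ≡ ys
prodFact-injective-descending {[]}     {[]}     _ _ _ _ _ = refl
prodFact-injective-descending {[]}     {y ∷ ys} _ _ _ (py ∷ _) eq = ⊥-elim (prodFact[p∷ps]≢1 ys py (sym eq))
prodFact-injective-descending {x ∷ xs} {[]}     _ _ (px ∷ _) _ eq = ⊥-elim (prodFact[p∷ps]≢1 xs px eq)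
prodFact-injective-descending {x ∷ xs} {y ∷ ys} dx dy (px ∷ pxs) (py ∷ pys) eq =
  cong₂ _∷_ x≡y (prodFact-injective-descending (tail dx) (tail dy) pxs pys tails≡)
  where
  x∣ys : x ∣ prodFact (y ∷ ys)
  x∣ys = subst (x ∣_) eq (x∣prodFact[x∷xs] x xs {{prime⇒nonZero px}})
  y∣xs : y ∣ prodFact (x ∷ xs)
  y∣xs = subst (y ∣_) (sym eq) (x∣prodFact[x∷xs] y ys {{prime⇒nonZero py}})
  x≡y : x ≡ y
  x≡y = ≤-antisym (prime∣prodFact⇒≤head px dy x∣ys) (prime∣prodFact⇒≤head py dx y∣xs)
  tails≡ : prodFact xs ≡ prodFact ys
  tails≡ = *-cancelˡ-≡ _ _ (x !) {{x !≢0}} (trans eq (cong (λ z → z ! * prodFact ys) (sym x≡y)))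

prodFact-injective : ∀ {xs ys} → All Prime xs → All Prime ys → prodFact xs ≡ prodFact ys → xs ↭ ys
prodFact-injective {xs} {ys} pxs pys eq =
  ↭-trans (↭-sym (sort-↭ xs)) (subst (_↭ ys) (sym sorted≡) (sort-↭ ys))
  where
  sorted≡ : sort xs ≡ sort ys
  sorted≡ = prodFact-injective-descending (sort-↗ xs) (sort-↗ ys)
              (All-resp-↭ (↭-sym (sort-↭ xs)) pxs) (All-resp-↭ (↭-sym (sort-↭ ys)) pys)
              (trans (prodFact-↭ (sort-↭ xs)) (trans eq (sym (prodFact-↭ (sort-↭ ys)))))

lemma2 : (n : ℕ) (λs μs : List ℕ) → PrimePartition n λs → PrimePartition n μs → ¬ (λs ↭ μs) → multinomial n λs ≢ multinomial n μs
lemma2 n λs μs (primeλ , Σλ) (primeμ , Σμ) λ≁μ eq =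
  λ≁μ (prodFact-injective primeλ primeμ (multinomial≡⇒prodFact≡ λs μs Σλ Σμ eq))
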